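{- For any $A'\subset B=B(n_1,\ldots,n_k)$, $$d_k(A')\le2^k|\operatorname{co}(A')\setminus A'|+2^{k+2}k(k+1)\min\{n_i\}^{ -1}|B|.$$
   Context: $B(n_1,\ldots,n_k)=\prod_{i=1}^k\{1,\ldots,n_i\}$. $d_k(X)=|X+X|-2^k|X|$. $\operatorname{co}(X)=\widetilde{\operatorname{co}}(X)\cap\mathbb{Z}^k$, where $\widetilde{\operatorname{co}}(X)$ is the real convex hull. -}

module Defs where

open import Data.Nat as ℕ using (ℕ; zero; suc; _⊔_)
open import Data.Integer as ℤ using (ℤ; +_)
open import Data.Rational as ℚ using (ℚ; 0ℚ; 1ℚ)
open import Data.Vec as Vec using (Vec; []; _∷_; zipWith; replicate; foldr)
open import Data.Vec.Properties using (≡-dec)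
open import Data.List as List using (List; []; _∷_; length; deduplicate; concatMap)
open import Data.List.Membership.Propositional using (_∈_; _∉_)
open import Data.List.Relation.Unary.All using (All)
open import Data.List.Relation.Unary.Unique.Propositional using (Unique)
open import Data.Product using (Σ; _×_; _,_; proj₁; proj₂)
open import Relation.Binary.PropositionalEquality using (_≡_)
open import Relation.Binary.Definitions using (DecidableEquality)

Pt : ℕ → Set
Pt k = Vec ℤ k

_≟ₚ_ : ∀ {k} → DecidableEquality (Pt k)
_≟ₚ_ = ≡-dec ℤ._≟_

InBox : ∀ {k} → Vec ℕ k → Pt k → Set
InBox [] [] = Data.Unit.⊤ where import Data.Unit
InBox (n ∷ ns) (x ∷ xs) = ((+ 1) ℤ.≤ x × x ℤ.≤ (+ n)) × InBox ns xs

boxSize : ∀ {k} → Vec ℕ k → ℕ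
boxSize = foldr _ ℕ._*_ 1

-- min{n_i} (for k ≥ 1; the value for k = 0 is never used)
vmin : ∀ {k} → Vec ℕ k → ℕ
vmin [] = 0
vmin (n ∷ []) = n
vmin (n ∷ m ∷ ns) = n ℕ.⊓ vmin (m ∷ ns)

-- a finite set of points is represented by a duplicate-free list
_+ₚ_ : ∀ {k} → Pt k → Pt k → Pt k
_+ₚ_ = zipWith ℤ._+_

sumset : ∀ {k} → List (Pt k) → List (Pt k)
sumset X = deduplicate _≟ₚ_ (concatMap (λ a → List.map (a +ₚ_) X) X)

d : (k : ℕ) → List (Pt k) → ℤ
d k X = (+ length (sumset X)) ℤ.- (+ (2 ℕ.^ k ℕ.* length X))

toℚ : ∀ {k} → Pt k → Vec ℚ k
toℚ = Vec.map (λ z → z ℚ./ 1)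

wsum : ∀ {k} → List (ℚ × Pt k) → Vec ℚ k
wsum [] = replicate _ 0ℚ
wsum ((l , p) ∷ ps) = zipWith ℚ._+_ (Vec.map (l ℚ.*_) (toℚ p)) (wsum ps)

weights : ∀ {k} → List (ℚ × Pt k) → ℚ
weights [] = 0ℚ
weights ((l , _) ∷ ps) = l ℚ.+ weights ps

-- x ∈ co(X) = conv_ℝ(X) ∩ ℤ^k : x is a convex combination of points of X.
-- (For rational points, real and rational convex combinations give the same
-- hull.)
InCo : ∀ {k} → List (Pt k) → Pt k → Set
InCo {k} X x = Σ (List (ℚ × Pt k)) λ c →
    All (λ lp → 0ℚ ℚ.≤ proj₁ lp × proj₂ lp ∈ X) c
  × weights c ≡ 1ℚ
  × wsum c ≡ toℚ x

EnumCoMinus : ∀ {k} → List (Pt k) → List (Pt k) → Set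
EnumCoMinus {k} X L = Unique L × (∀ (x : Pt k) → (x ∈ L → InCo X x × x ∉ X) × (InCo X x × x ∉ X → x ∈ L))

{-# OPTIONS --safe #-}

-- Write z ∈ A' + A' as z = e + 2w with e ∈ {0,1}^k; then w + e/2 = z/2 lies in the convex hull of A', and
-- w lies in the box B. If w ∈ co(A') = A' ∪ L, record (e , w). Otherwise e ≠ 0 and w is the topmost point u
-- of the line w + ℤe with u + e/2 in the hull: if u and u + de (d ≥ 1) both have this property, then u + de
-- is a convex combination of u + e/2 and u + de + e/2, hence lies in co(A'). So w is determined by e and its
-- line, and we record (e , w') where w' is w slid along -e onto a face {xⱼ = 1} of B. This encoding is
-- injective, and the faces have at most k|B|/min nᵢ points, so |A' + A'| ≤ 2^k (|A'| + |L| + k|B|/min nᵢ).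

module Submission where

open import Defs
open import Data.Nat as ℕ using (ℕ; _≤_)
open import Data.Integer as ℤ using (ℤ; +_)
open import Data.Vec using (Vec)
open import Data.Vec.Relation.Unary.All as VAll using ()
open import Data.List using (List; length)
open import Data.List.Relation.Unary.All using (All)
open import Data.List.Relation.Unary.Unique.Propositional using (Unique)

open import Data.Empty using (⊥-elim)
open import Data.Fin using (Fin; zero; suc)
open import Data.Fin.Properties using (¬∀⟶∃¬)
open import Data.Integer using (+≤+)
import Data.Integer.DivMod as ℤD
import Data.Integer.Properties as ℤP
import Data.Integer.Solver as ℤSolver
open import Data.List
  using ([]; _∷_; _++_; map; concatMap; cartesianProductWith; cartesianProduct; filter; upTo; allFin)
open import Data.List.Extrema ℤP.≤-totalOrder using (min; max; argmin-sel; min≤xs; xs≤max)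
open import Data.List.Membership.Propositional using (_∈_; _∉_; _─_; lose; find)
open import Data.List.Membership.Propositional.Properties
  using (∈-map⁺; ∈-map⁻; ∈-filter⁺; ∈-filter⁻; ∈-allFin; ∈-upTo⁺; ∈-cartesianProductWith⁺;
         ∈-cartesianProduct⁺; ∈-concatMap⁺; ∈-concatMap⁻; ∈-deduplicate⁻; ∈-++⁺ˡ; ∈-++⁺ʳ)
import Data.List.Properties as ListP
open import Data.List.Relation.Unary.All using ([]; _∷_)
import Data.List.Relation.Unary.All as All
import Data.List.Relation.Unary.All.Properties as AllP
open import Data.List.Relation.Unary.AllPairs using (_∷_)
open import Data.List.Relation.Unary.Any using (here; there)
open import Data.Nat using (zero; suc; z≤n; s≤s)
import Data.Nat.DivMod as ℕD
import Data.Nat.Properties as ℕP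
open import Algebra.Properties.CommutativeSemigroup ℕP.*-commutativeSemigroup using (x∙yz≈y∙xz)
import Data.Nat.Solver as ℕSolver
open import Data.Product using (Σ; ∃; _×_; _,_; proj₁; proj₂; map₁)
open import Data.Rational as ℚ using (ℚ; 0ℚ; 1ℚ; ½)
import Data.Rational.Properties as ℚP
import Data.Rational.Solver as ℚSolver
import Data.Rational.Unnormalised as ℚᵘ
import Data.Rational.Unnormalised.Properties as ℚᵘP
open import Data.Sum using (_⊎_; inj₁; inj₂)
open import Data.Unit using (tt)
open import Data.Vec using ([]; _∷_; lookup; zipWith; _[_]≔_) renaming (map to mapᵥ)
import Data.Vec.Properties as VecP
open import Function using (id; _∘_)
open import Relation.Binary.PropositionalEquality
open import Relation.Nullary using (yes; no)

module _ {a} {A : Set a} where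

  ∈-─ : ∀ {x y : A} {ys} (p : x ∈ ys) → y ∈ ys → y ≢ x → y ∈ ys ─ p
  ∈-─ (here refl) (here refl) y≢x = ⊥-elim (y≢x refl)
  ∈-─ (here refl) (there q)   _   = q
  ∈-─ (there p)   (here refl) _   = here refl
  ∈-─ (there p)   (there q)   y≢x = there (∈-─ p q y≢x)

module _ {a b} {A : Set a} {B : Set b} where

  injectiveOn⇒length≤ : ∀ (f : A → B) {xs ys} → Unique xs → (∀ {x} → x ∈ xs → f x ∈ ys) →
                        (∀ {x y} → x ∈ xs → y ∈ xs → f x ≡ f y → x ≡ y) → length xs ≤ length ys
  injectiveOn⇒length≤ f {[]}     _            _    _   = z≤n
  injectiveOn⇒length≤ f {x ∷ xs} {ys} (x∉xs ∷ xs!) into inj = begin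
    suc (length xs)           ≤⟨ s≤s (injectiveOn⇒length≤ f xs! into′ (λ p q → inj (there p) (there q))) ⟩
    suc (length (ys ─ fx∈ys)) ≡⟨ ListP.length-removeAt′ ys _ ⟨
    length ys                 ∎
    where
    open ℕP.≤-Reasoning
    fx∈ys : f x ∈ ys
    fx∈ys = into (here refl)
    into′ : ∀ {y} → y ∈ xs → f y ∈ ys ─ fx∈ys
    into′ y∈xs = ∈-─ fx∈ys (into (there y∈xs)) λ fy≡fx → All.lookup x∉xs y∈xs (sym (inj (there y∈xs) (here refl) fy≡fx))

  *-length-concatMap≤ : ∀ (f : A → List B) m bound xs → (∀ x → m ℕ.* length (f x) ≤ bound) →
                        m ℕ.* length (concatMap f xs) ≤ length xs ℕ.* bound
  *-length-concatMap≤ f m bound []       _ = ℕP.≤-reflexive (ℕP.*-zeroʳ m)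
  *-length-concatMap≤ f m bound (x ∷ xs) h = begin
    m ℕ.* length (f x ++ concatMap f xs)                  ≡⟨ cong (m ℕ.*_) (ListP.length-++ (f x)) ⟩
    m ℕ.* (length (f x) ℕ.+ length (concatMap f xs))      ≡⟨ ℕP.*-distribˡ-+ m (length (f x)) _ ⟩
    m ℕ.* length (f x) ℕ.+ m ℕ.* length (concatMap f xs)  ≤⟨ ℕP.+-mono-≤ (h x) (*-length-concatMap≤ f m bound xs h) ⟩
    bound ℕ.+ length xs ℕ.* bound                         ∎
    where open ℕP.≤-Reasoning

module _ {a b c} {A : Set a} {B : Set b} {C : Set c} where

  length-cartesianProductWith : ∀ (f : A → B → C) xs ys →
                                length (cartesianProductWith f xs ys) ≡ length xs ℕ.* length ys
  length-cartesianProductWith f []       ys = refl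
  length-cartesianProductWith f (x ∷ xs) ys = begin
    length (map (f x) ys ++ cartesianProductWith f xs ys)
      ≡⟨ ListP.length-++ (map (f x) ys) ⟩
    length (map (f x) ys) ℕ.+ length (cartesianProductWith f xs ys)
      ≡⟨ cong₂ ℕ._+_ (ListP.length-map (f x) ys) (length-cartesianProductWith f xs ys) ⟩
    length ys ℕ.+ length xs ℕ.* length ys ∎
    where open ≡-Reasoning

min∈ : ∀ {⊤ x xs} → x ∈ xs → All (ℤ._≤ ⊤) xs → min ⊤ xs ∈ xs
min∈ {⊤} {x} {xs} x∈xs xs≤⊤ with argmin-sel id ⊤ xs
... | inj₂ min∈xs = min∈xs
... | inj₁ min≡⊤  = subst (_∈ xs) x≡min x∈xs
  where
  x≡min : x ≡ min ⊤ xs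
  x≡min = ℤP.≤-antisym (subst (x ℤ.≤_) (sym min≡⊤) (All.lookup xs≤⊤ x∈xs)) (All.lookup (min≤xs ⊤ xs) x∈xs)

lookup-≗⇒≡ : ∀ {a} {A : Set a} {m} (xs ys : Vec A m) → (∀ i → lookup xs i ≡ lookup ys i) → xs ≡ ys
lookup-≗⇒≡ xs ys eq = trans (sym (VecP.tabulate∘lookup xs)) (trans (VecP.tabulate-cong eq) (VecP.tabulate∘lookup ys))

ι : ℤ → ℚ
ι a = a ℚ./ 1

toℚᵘ-/ : ∀ a m → ℚ.toℚᵘ (a ℚ./ suc m) ℚᵘ.≃ ℚᵘ.mkℚᵘ a m
toℚᵘ-/ a m = ℚP.toℚᵘ-fromℚᵘ (ℚᵘ.mkℚᵘ a m)

ι-+ : ∀ a b → ι (a ℤ.+ b) ≡ ι a ℚ.+ ι b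
ι-+ a b = ℚP.toℚᵘ-injective (begin
  ℚ.toℚᵘ (ι (a ℤ.+ b))            ≈⟨ toℚᵘ-/ (a ℤ.+ b) 0 ⟩
  ℚᵘ.mkℚᵘ (a ℤ.+ b) 0              ≈⟨ ℚᵘ.*≡* (cong (ℤ._* + 1) a+b≡a*1+b*1) ⟩
  ℚᵘ.mkℚᵘ a 0 ℚᵘ.+ ℚᵘ.mkℚᵘ b 0    ≈⟨ ℚᵘP.+-cong (toℚᵘ-/ a 0) (toℚᵘ-/ b 0) ⟨
  ℚ.toℚᵘ (ι a) ℚᵘ.+ ℚ.toℚᵘ (ι b)  ≈⟨ ℚP.toℚᵘ-homo-+ (ι a) (ι b) ⟨
  ℚ.toℚᵘ (ι a ℚ.+ ι b)            ∎)
  where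
  open ℚᵘP.≃-Reasoning
  a+b≡a*1+b*1 : a ℤ.+ b ≡ a ℤ.* + 1 ℤ.+ b ℤ.* + 1
  a+b≡a*1+b*1 = sym (cong₂ ℤ._+_ (ℤP.*-identityʳ a) (ℤP.*-identityʳ b))

ι-* : ∀ a b → ι (a ℤ.* b) ≡ ι a ℚ.* ι b
ι-* a b = ℚP.toℚᵘ-injective (begin
  ℚ.toℚᵘ (ι (a ℤ.* b))            ≈⟨ toℚᵘ-/ (a ℤ.* b) 0 ⟩
  ℚᵘ.mkℚᵘ a 0 ℚᵘ.* ℚᵘ.mkℚᵘ b 0    ≈⟨ ℚᵘP.*-cong (toℚᵘ-/ a 0) (toℚᵘ-/ b 0) ⟨
  ℚ.toℚᵘ (ι a) ℚᵘ.* ℚ.toℚᵘ (ι b)  ≈⟨ ℚP.toℚᵘ-homo-* (ι a) (ι b) ⟨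
  ℚ.toℚᵘ (ι a ℚ.* ι b)            ∎)
  where open ℚᵘP.≃-Reasoning

1/[1+m]+m/[1+m]≡1 : ∀ m → + 1 ℚ./ suc m ℚ.+ + m ℚ./ suc m ≡ 1ℚ
1/[1+m]+m/[1+m]≡1 m = ℚP.toℚᵘ-injective (begin
  ℚ.toℚᵘ (+ 1 ℚ./ suc m ℚ.+ + m ℚ./ suc m)  ≈⟨ ℚP.toℚᵘ-homo-+ (+ 1 ℚ./ suc m) (+ m ℚ./ suc m) ⟩
  _                                         ≈⟨ ℚᵘP.+-cong (toℚᵘ-/ (+ 1) m) (toℚᵘ-/ (+ m) m) ⟩
  ℚᵘ.mkℚᵘ (+ 1) m ℚᵘ.+ ℚᵘ.mkℚᵘ (+ m) m      ≈⟨ ℚᵘ.*≡* (solve 1 (λ m → (one :* (one :+ m) :+ m :* (one :+ m)) :* one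
                                                                     := one :* ((one :+ m) :* (one :+ m))) refl (+ m)) ⟩
  ℚᵘ.1ℚᵘ                                    ∎)
  where
  open ℚᵘP.≃-Reasoning
  open ℤSolver.+-*-Solver
  one = con (+ 1)

1/[1+m]*[1+m]≡1 : ∀ m → (+ 1 ℚ./ suc m) ℚ.* ι (+ suc m) ≡ 1ℚ
1/[1+m]*[1+m]≡1 m = ℚP.toℚᵘ-injective (begin
  ℚ.toℚᵘ ((+ 1 ℚ./ suc m) ℚ.* ι (+ suc m))  ≈⟨ ℚP.toℚᵘ-homo-* (+ 1 ℚ./ suc m) (ι (+ suc m)) ⟩
  _                                         ≈⟨ ℚᵘP.*-cong (toℚᵘ-/ (+ 1) m) (toℚᵘ-/ (+ suc m) 0) ⟩
  ℚᵘ.mkℚᵘ (+ 1) m ℚᵘ.* ℚᵘ.mkℚᵘ (+ suc m) 0  ≈⟨ ℚᵘ.*≡* (solve 1 (λ m → (one :* (one :+ m)) :* one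
                                                                     := one :* ((one :+ m) :* one)) refl (+ m)) ⟩
  ℚᵘ.1ℚᵘ                                    ∎)
  where
  open ℚᵘP.≃-Reasoning
  open ℤSolver.+-*-Solver
  one = con (+ 1)

0≤+i/[1+m] : ∀ i m → 0ℚ ℚ.≤ + i ℚ./ suc m
0≤+i/[1+m] i m = ℚP.nonNegative⁻¹ _ {{ℚP.normalize-nonNeg i (suc m)}}

0ℚ≤½ : 0ℚ ℚ.≤ ½
0ℚ≤½ = ℚP.nonNegative⁻¹ ½

1/[2+2j]*[1+j]≡½ : ∀ j → (+ 1 ℚ./ suc (j ℕ.+ suc j)) ℚ.* ι (+ suc j) ≡ ½
1/[2+2j]*[1+j]≡½ j = begin
  s ℚ.* D                                ≡⟨ solve 2 (λ s D → s :* D := con ½ :* (s :* (D :+ D))) refl s D ⟩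
  ½ ℚ.* (s ℚ.* (D ℚ.+ D))                ≡⟨ cong (λ x → ½ ℚ.* (s ℚ.* x)) (ι-+ (+ suc j) (+ suc j)) ⟨
  ½ ℚ.* (s ℚ.* ι (+ suc (j ℕ.+ suc j)))  ≡⟨ cong (½ ℚ.*_) (1/[1+m]*[1+m]≡1 (j ℕ.+ suc j)) ⟩
  ½                                      ∎
  where
  open ≡-Reasoning
  open ℚSolver.+-*-Solver
  s = + 1 ℚ./ suc (j ℕ.+ suc j)
  D = ι (+ suc j)

ι[h]+½ι[e]≡½ι[x]+½ι[y] : ∀ x y e h → x ℤ.+ y ≡ e ℤ.+ + 2 ℤ.* h →
                         ι h ℚ.+ ½ ℚ.* ι e ≡ ½ ℚ.* ι x ℚ.+ ½ ℚ.* ι y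
ι[h]+½ι[e]≡½ι[x]+½ι[y] x y e h x+y≡e+2h = begin
  ι h ℚ.+ ½ ℚ.* ι e                ≡⟨ solve 2 (λ h e → h :+ con ½ :* e := con ½ :* (e :+ con (ι (+ 2)) :* h))
                                            refl (ι h) (ι e) ⟩
  ½ ℚ.* (ι e ℚ.+ ι (+ 2) ℚ.* ι h)  ≡⟨ cong (½ ℚ.*_) (trans (ι-+ e (+ 2 ℤ.* h)) (cong (ℚ._+_ (ι e)) (ι-* (+ 2) h))) ⟨
  ½ ℚ.* ι (e ℤ.+ + 2 ℤ.* h)        ≡⟨ cong (λ u → ½ ℚ.* ι u) x+y≡e+2h ⟨
  ½ ℚ.* ι (x ℤ.+ y)                ≡⟨ cong (½ ℚ.*_) (ι-+ x y) ⟩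
  ½ ℚ.* (ι x ℚ.+ ι y)              ≡⟨ ℚP.*-distribˡ-+ ½ (ι x) (ι y) ⟩
  ½ ℚ.* ι x ℚ.+ ½ ℚ.* ι y          ∎
  where
  open ≡-Reasoning
  open ℚSolver.+-*-Solver

segment-identity : ∀ s t D W E → s ℚ.+ t ≡ 1ℚ → s ℚ.* D ≡ ½ →
                   W ℚ.+ D ℚ.* E ≡ s ℚ.* (W ℚ.+ ½ ℚ.* E) ℚ.+ t ℚ.* ((W ℚ.+ D ℚ.* E) ℚ.+ ½ ℚ.* E)
segment-identity s t D W E s+t≡1 s*D≡½ = begin
  W ℚ.+ D ℚ.* E
    ≡⟨ solve 4 (λ D W E h → W :+ D :* E := con 1ℚ :* (W :+ h :* E :+ D :* E) :- h :* E) refl D W E ½ ⟩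
  1ℚ ℚ.* (W ℚ.+ ½ ℚ.* E ℚ.+ D ℚ.* E) ℚ.- ½ ℚ.* E
    ≡⟨ cong₂ (λ a b → a ℚ.* (W ℚ.+ ½ ℚ.* E ℚ.+ D ℚ.* E) ℚ.- b ℚ.* E) s+t≡1 s*D≡½ ⟨
  (s ℚ.+ t) ℚ.* (W ℚ.+ ½ ℚ.* E ℚ.+ D ℚ.* E) ℚ.- (s ℚ.* D) ℚ.* E
    ≡⟨ solve 6 (λ s t D W E h → (s :+ t) :* (W :+ h :* E :+ D :* E) :- (s :* D) :* E
                                := s :* (W :+ h :* E) :+ t :* ((W :+ D :* E) :+ h :* E)) refl s t D W E ½ ⟩
  s ℚ.* (W ℚ.+ ½ ℚ.* E) ℚ.+ t ℚ.* ((W ℚ.+ D ℚ.* E) ℚ.+ ½ ℚ.* E) ∎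
  where
  open ≡-Reasoning
  open ℚSolver.+-*-Solver

-- Convex hulls

lookup-toℚ : ∀ {k} (x : Pt k) i → lookup (toℚ x) i ≡ ι (lookup x i)
lookup-toℚ x i = VecP.lookup-map i ι x

module _ {k : ℕ} where

  open import Data.Rational using (_+_; _*_)

  Combination : Set
  Combination = List (ℚ × Pt k)

  CoefficientIn : List (Pt k) → ℚ × Pt k → Set
  CoefficientIn X lp = 0ℚ ℚ.≤ proj₁ lp × proj₂ lp ∈ X

  -- InCo X x unfolds to InHull X (toℚ x)
  InHull : List (Pt k) → Vec ℚ k → Set
  InHull X p = Σ Combination λ c → All (CoefficientIn X) c × weights c ≡ 1ℚ × wsum c ≡ p

  lookup-wsum-∷ : ∀ l (p : Pt k) c i → lookup (wsum ((l , p) ∷ c)) i ≡ l * ι (lookup p i) + lookup (wsum c) i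
  lookup-wsum-∷ l p c i = trans (VecP.lookup-zipWith _+_ i (mapᵥ (l *_) (toℚ p)) (wsum c))
    (cong (_+ lookup (wsum c) i) (trans (VecP.lookup-map i (l *_) (toℚ p)) (cong (l *_) (lookup-toℚ p i))))

  scale : ℚ → Combination → Combination
  scale s = map (map₁ (s *_))

  weights-++ : ∀ (c d : Combination) → weights (c ++ d) ≡ weights c + weights d
  weights-++ []            d = sym (ℚP.+-identityˡ (weights d))
  weights-++ ((l , _) ∷ c) d = trans (cong (_+_ l) (weights-++ c d)) (sym (ℚP.+-assoc l (weights c) (weights d)))

  weights-scale : ∀ s (c : Combination) → weights (scale s c) ≡ s * weights c
  weights-scale s []            = sym (ℚP.*-zeroʳ s)
  weights-scale s ((l , _) ∷ c) = trans (cong (_+_ (s * l)) (weights-scale s c)) (sym (ℚP.*-distribˡ-+ s l (weights c)))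

  lookup-wsum-++ : ∀ (c d : Combination) i → lookup (wsum (c ++ d)) i ≡ lookup (wsum c) i + lookup (wsum d) i
  lookup-wsum-++ [] d i = sym (trans (cong (_+ lookup (wsum d) i) (VecP.lookup-replicate i 0ℚ)) (ℚP.+-identityˡ _))
  lookup-wsum-++ ((l , p) ∷ c) d i = begin
    lookup (wsum ((l , p) ∷ c ++ d)) i                           ≡⟨ lookup-wsum-∷ l p (c ++ d) i ⟩
    l * ι (lookup p i) + lookup (wsum (c ++ d)) i                ≡⟨ cong (_+_ (l * ι (lookup p i))) (lookup-wsum-++ c d i) ⟩
    l * ι (lookup p i) + (lookup (wsum c) i + lookup (wsum d) i) ≡⟨ ℚP.+-assoc (l * ι (lookup p i)) _ _ ⟨
    l * ι (lookup p i) + lookup (wsum c) i + lookup (wsum d) i   ≡⟨ cong (_+ lookup (wsum d) i) (lookup-wsum-∷ l p c i) ⟨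
    lookup (wsum ((l , p) ∷ c)) i + lookup (wsum d) i            ∎
    where open ≡-Reasoning

  lookup-wsum-scale : ∀ s (c : Combination) i → lookup (wsum (scale s c)) i ≡ s * lookup (wsum c) i
  lookup-wsum-scale s [] i = trans (VecP.lookup-replicate i 0ℚ) (sym (trans (cong (s *_) (VecP.lookup-replicate i 0ℚ)) (ℚP.*-zeroʳ s)))
  lookup-wsum-scale s ((l , p) ∷ c) i = begin
    lookup (wsum (scale s ((l , p) ∷ c))) i                ≡⟨ lookup-wsum-∷ (s * l) p (scale s c) i ⟩
    s * l * ι (lookup p i) + lookup (wsum (scale s c)) i   ≡⟨ cong₂ _+_ (ℚP.*-assoc s l _) (lookup-wsum-scale s c i) ⟩
    s * (l * ι (lookup p i)) + s * lookup (wsum c) i       ≡⟨ ℚP.*-distribˡ-+ s _ _ ⟨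
    s * (l * ι (lookup p i) + lookup (wsum c) i)           ≡⟨ cong (s *_) (lookup-wsum-∷ l p c i) ⟨
    s * lookup (wsum ((l , p) ∷ c)) i                      ∎
    where open ≡-Reasoning

  All-scale : ∀ {X s} → 0ℚ ℚ.≤ s → ∀ {c : Combination} → All (CoefficientIn X) c → All (CoefficientIn X) (scale s c)
  All-scale 0≤s [] = []
  All-scale {s = s} 0≤s {(l , _) ∷ _} ((0≤l , p∈X) ∷ c∈X) = (0≤s*l , p∈X) ∷ All-scale 0≤s c∈X
    where
    0≤s*l : 0ℚ ℚ.≤ s * l
    0≤s*l = ℚP.nonNegative⁻¹ _ {{ℚP.nonNeg*nonNeg⇒nonNeg s {{ℚ.nonNegative 0≤s}} l {{ℚ.nonNegative 0≤l}}}}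

  InHull-point : ∀ {X x} → x ∈ X → InHull X (toℚ x)
  InHull-point {x = x} x∈X = (1ℚ , x) ∷ [] , (ℚP.nonNegative⁻¹ 1ℚ , x∈X) ∷ [] , refl , lookup-≗⇒≡ _ _ coords
    where
    coords : ∀ i → lookup (wsum ((1ℚ , x) ∷ [])) i ≡ lookup (toℚ x) i
    coords i = begin
      lookup (wsum ((1ℚ , x) ∷ [])) i       ≡⟨ lookup-wsum-∷ 1ℚ x [] i ⟩
      1ℚ * ι (lookup x i) + lookup (wsum {k} []) i ≡⟨ cong₂ _+_ (ℚP.*-identityˡ (ι (lookup x i))) (VecP.lookup-replicate i 0ℚ) ⟩
      ι (lookup x i) + 0ℚ                   ≡⟨ ℚP.+-identityʳ (ι (lookup x i)) ⟩
      ι (lookup x i)                        ≡⟨ lookup-toℚ x i ⟨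
      lookup (toℚ x) i                      ∎
      where open ≡-Reasoning

  InHull-convex : ∀ {X p q r} {s t : ℚ} → 0ℚ ℚ.≤ s → 0ℚ ℚ.≤ t → s + t ≡ 1ℚ → InHull X p → InHull X q →
                  (∀ i → lookup r i ≡ s * lookup p i + t * lookup q i) → InHull X r
  InHull-convex {p = p} {q} {r} {s} {t} 0≤s 0≤t s+t≡1 (c , c∈X , Σc≡1 , c↦p) (d , d∈X , Σd≡1 , d↦q) r≡ =
    scale s c ++ scale t d , AllP.++⁺ (All-scale 0≤s c∈X) (All-scale 0≤t d∈X) , total≡1 , lookup-≗⇒≡ _ _ coords
    where
    open ≡-Reasoning
    total≡1 : weights (scale s c ++ scale t d) ≡ 1ℚ
    total≡1 = begin
      weights (scale s c ++ scale t d)         ≡⟨ weights-++ (scale s c) (scale t d) ⟩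
      weights (scale s c) + weights (scale t d) ≡⟨ cong₂ _+_ (weights-scale s c) (weights-scale t d) ⟩
      s * weights c + t * weights d            ≡⟨ cong₂ (λ u v → s * u + t * v) Σc≡1 Σd≡1 ⟩
      s * 1ℚ + t * 1ℚ                          ≡⟨ cong₂ _+_ (ℚP.*-identityʳ s) (ℚP.*-identityʳ t) ⟩
      s + t                                    ≡⟨ s+t≡1 ⟩
      1ℚ                                       ∎
    coords : ∀ i → lookup (wsum (scale s c ++ scale t d)) i ≡ lookup r i
    coords i = begin
      lookup (wsum (scale s c ++ scale t d)) i                      ≡⟨ lookup-wsum-++ (scale s c) (scale t d) i ⟩
      lookup (wsum (scale s c)) i + lookup (wsum (scale t d)) i     ≡⟨ cong₂ _+_ (lookup-wsum-scale s c i) (lookup-wsum-scale t d i) ⟩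
      s * lookup (wsum c) i + t * lookup (wsum d) i                 ≡⟨ cong₂ (λ u v → s * lookup u i + t * lookup v i) c↦p d↦q ⟩
      s * lookup p i + t * lookup q i                               ≡⟨ r≡ i ⟨
      lookup r i                                                    ∎

-- Lattice points and their parity

infixr 25 _·ₚ_

_·ₚ_ : ∀ {k} → ℤ → Pt k → Pt k
c ·ₚ e = mapᵥ (c ℤ.*_) e

%ℕ2≡0⊎1 : ∀ a → + (a ℤD.%ℕ 2) ≡ + 0 ⊎ + (a ℤD.%ℕ 2) ≡ + 1
%ℕ2≡0⊎1 a = bit (ℤD.n%ℕd<d a 2)
  where
  bit : ∀ {r} → r ℕ.< 2 → + r ≡ + 0 ⊎ + r ≡ + 1
  bit {0} _ = inj₁ refl
  bit {1} _ = inj₂ refl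
  bit {suc (suc _)} (s≤s (s≤s ()))

IsBitVector : ∀ {k} → Pt k → Set
IsBitVector e = ∀ i → lookup e i ≡ + 0 ⊎ lookup e i ≡ + 1

parity : ∀ {k} → Pt k → Pt k
parity = mapᵥ (λ a → + (a ℤD.%ℕ 2))

halve : ∀ {k} → Pt k → Pt k
halve = mapᵥ (ℤD._/ℕ 2)

_+½_ : ∀ {k} → Pt k → Pt k → Vec ℚ k
w +½ e = zipWith (λ a b → ι a ℚ.+ ½ ℚ.* ι b) w e

module _ {k : ℕ} where

  lookup-+ₚ·ₚ : ∀ (w : Pt k) c e i → lookup (w +ₚ c ·ₚ e) i ≡ lookup w i ℤ.+ c ℤ.* lookup e i
  lookup-+ₚ·ₚ w c e i = trans (VecP.lookup-zipWith ℤ._+_ i w (c ·ₚ e)) (cong (ℤ._+_ (lookup w i)) (VecP.lookup-map i (c ℤ.*_) e))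

  +ₚ-0·ₚ : ∀ (w e : Pt k) → w +ₚ (+ 0) ·ₚ e ≡ w
  +ₚ-0·ₚ w e = lookup-≗⇒≡ _ _ λ i → trans (lookup-+ₚ·ₚ w (+ 0) e i) (ℤP.+-identityʳ (lookup w i))

  +ₚ·ₚ-cancel : ∀ (w v : Pt k) a b e → w +ₚ a ·ₚ e ≡ v +ₚ b ·ₚ e → v ≡ w +ₚ (a ℤ.- b) ·ₚ e
  +ₚ·ₚ-cancel w v a b e eq = lookup-≗⇒≡ _ _ λ i → begin
    lookup v i                                   ≡⟨ solve 3 (λ v b e → v := v :+ b :* e :- b :* e) refl _ b _ ⟩
    lookup v i ℤ.+ b ℤ.* lookup e i ℤ.- b ℤ.* lookup e i ≡⟨ cong (ℤ._- b ℤ.* lookup e i) (coordinate i) ⟨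
    lookup w i ℤ.+ a ℤ.* lookup e i ℤ.- b ℤ.* lookup e i
      ≡⟨ solve 4 (λ w a b e → w :+ a :* e :- b :* e := w :+ (a :- b) :* e) refl (lookup w i) a b (lookup e i) ⟩
    lookup w i ℤ.+ (a ℤ.- b) ℤ.* lookup e i      ≡⟨ lookup-+ₚ·ₚ w (a ℤ.- b) e i ⟨
    lookup (w +ₚ (a ℤ.- b) ·ₚ e) i               ∎
    where
    open ≡-Reasoning
    open ℤSolver.+-*-Solver
    coordinate : ∀ i → lookup w i ℤ.+ a ℤ.* lookup e i ≡ lookup v i ℤ.+ b ℤ.* lookup e i
    coordinate i = trans (sym (lookup-+ₚ·ₚ w a e i)) (trans (cong (λ u → lookup u i) eq) (lookup-+ₚ·ₚ v b e i))

  parity+2·halve : ∀ (z : Pt k) → z ≡ parity z +ₚ (+ 2) ·ₚ halve z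
  parity+2·halve z = lookup-≗⇒≡ _ _ λ i → begin
    lookup z i                                                 ≡⟨ ℤD.a≡a%ℕn+[a/ℕn]*n (lookup z i) 2 ⟩
    + (lookup z i ℤD.%ℕ 2) ℤ.+ (lookup z i ℤD./ℕ 2) ℤ.* + 2
      ≡⟨ cong₂ ℤ._+_ (VecP.lookup-map i _ z) (trans (cong (+ 2 ℤ.*_) (VecP.lookup-map i _ z)) (ℤP.*-comm (+ 2) _)) ⟨
    lookup (parity z) i ℤ.+ + 2 ℤ.* lookup (halve z) i         ≡⟨ lookup-+ₚ·ₚ (parity z) (+ 2) (halve z) i ⟨
    lookup (parity z +ₚ (+ 2) ·ₚ halve z) i                      ∎
    where open ≡-Reasoning

  parity-isBitVector : ∀ (z : Pt k) → IsBitVector (parity z)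
  parity-isBitVector z i rewrite VecP.lookup-map i (λ a → + (a ℤD.%ℕ 2)) z = %ℕ2≡0⊎1 (lookup z i)

  lookup-+½ : ∀ (w e : Pt k) i → lookup (w +½ e) i ≡ ι (lookup w i) ℚ.+ ½ ℚ.* ι (lookup e i)
  lookup-+½ w e i = VecP.lookup-zipWith _ i w e

  halve+½parity∈hull : ∀ {X x y} → x ∈ X → y ∈ X → InHull X (halve (x +ₚ y) +½ parity (x +ₚ y))
  halve+½parity∈hull {X} {x} {y} x∈X y∈X =
    InHull-convex 0ℚ≤½ 0ℚ≤½ refl (InHull-point x∈X) (InHull-point y∈X) λ i → begin
      lookup (halve z +½ parity z) i                   ≡⟨ lookup-+½ (halve z) (parity z) i ⟩
      ι (lookup (halve z) i) ℚ.+ ½ ℚ.* ι (lookup (parity z) i)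
        ≡⟨ ι[h]+½ι[e]≡½ι[x]+½ι[y] (lookup x i) (lookup y i) (lookup (parity z) i) (lookup (halve z) i) (coordinate i) ⟩
      ½ ℚ.* ι (lookup x i) ℚ.+ ½ ℚ.* ι (lookup y i)
        ≡⟨ cong₂ (λ a b → ½ ℚ.* a ℚ.+ ½ ℚ.* b) (lookup-toℚ x i) (lookup-toℚ y i) ⟨
      ½ ℚ.* lookup (toℚ x) i ℚ.+ ½ ℚ.* lookup (toℚ y) i ∎
    where
    open ≡-Reasoning
    z = x +ₚ y
    coordinate : ∀ i → lookup x i ℤ.+ lookup y i ≡ lookup (parity z) i ℤ.+ + 2 ℤ.* lookup (halve z) i
    coordinate i = begin
      lookup x i ℤ.+ lookup y i                          ≡⟨ VecP.lookup-zipWith ℤ._+_ i x y ⟨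
      lookup z i                                         ≡⟨ cong (λ u → lookup u i) (parity+2·halve z) ⟩
      lookup (parity z +ₚ (+ 2) ·ₚ halve z) i             ≡⟨ lookup-+ₚ·ₚ (parity z) (+ 2) (halve z) i ⟩
      lookup (parity z) i ℤ.+ + 2 ℤ.* lookup (halve z) i ∎

  +½-zero : ∀ (w e : Pt k) → (∀ i → lookup e i ≡ + 0) → w +½ e ≡ toℚ w
  +½-zero w e e≡0 = lookup-≗⇒≡ _ _ λ i → begin
    lookup (w +½ e) i                       ≡⟨ lookup-+½ w e i ⟩
    ι (lookup w i) ℚ.+ ½ ℚ.* ι (lookup e i) ≡⟨ cong (λ a → ι (lookup w i) ℚ.+ ½ ℚ.* ι a) (e≡0 i) ⟩
    ι (lookup w i) ℚ.+ 0ℚ                   ≡⟨ ℚP.+-identityʳ (ι (lookup w i)) ⟩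
    ι (lookup w i)                          ≡⟨ lookup-toℚ w i ⟨
    lookup (toℚ w) i                        ∎
    where open ≡-Reasoning

  -- w + (1+j) e lies on the segment from w + e/2 to w + (1+j) e + e/2
  InHull-ray : ∀ {X} {w e : Pt k} j → InHull X (w +½ e) → InHull X ((w +ₚ (+ suc j) ·ₚ e) +½ e) →
               InCo X (w +ₚ (+ suc j) ·ₚ e)
  InHull-ray {X} {w} {e} j w∈hull v∈hull =
    InHull-convex (0≤+i/[1+m] 1 m) (0≤+i/[1+m] m m) (1/[1+m]+m/[1+m]≡1 m) w∈hull v∈hull λ i → begin
      lookup (toℚ v) i                                ≡⟨ trans (lookup-toℚ v i) (ι[vᵢ] i) ⟩
      ι (lookup w i) ℚ.+ D ℚ.* ι (lookup e i)
        ≡⟨ segment-identity s t D (ι (lookup w i)) (ι (lookup e i)) (1/[1+m]+m/[1+m]≡1 m) (1/[2+2j]*[1+j]≡½ j) ⟩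
      s ℚ.* (ι (lookup w i) ℚ.+ ½ ℚ.* ι (lookup e i))
        ℚ.+ t ℚ.* (ι (lookup w i) ℚ.+ D ℚ.* ι (lookup e i) ℚ.+ ½ ℚ.* ι (lookup e i))
        ≡⟨ cong₂ (λ a b → s ℚ.* a ℚ.+ t ℚ.* b) (lookup-+½ w e i)
                 (trans (lookup-+½ v e i) (cong (ℚ._+ ½ ℚ.* ι (lookup e i)) (ι[vᵢ] i))) ⟨
      s ℚ.* lookup (w +½ e) i ℚ.+ t ℚ.* lookup (v +½ e) i ∎
    where
    open ≡-Reasoning
    m = j ℕ.+ suc j
    s = + 1 ℚ./ suc m
    t = + m ℚ./ suc m
    D = ι (+ suc j)
    v = w +ₚ (+ suc j) ·ₚ e
    ι[vᵢ] : ∀ i → ι (lookup v i) ≡ ι (lookup w i) ℚ.+ D ℚ.* ι (lookup e i)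
    ι[vᵢ] i = trans (cong ι (lookup-+ₚ·ₚ w (+ suc j) e i))
                    (trans (ι-+ (lookup w i) _) (cong (ℚ._+_ (ι (lookup w i))) (ι-* (+ suc j) (lookup e i))))

-- Boxes and their faces

InRange : ℕ → ℤ → Set
InRange m x = + 1 ℤ.≤ x × x ℤ.≤ + m

InBox⇒InRange : ∀ {k} {n : Vec ℕ k} {v} → InBox n v → ∀ i → InRange (lookup n i) (lookup v i)
InBox⇒InRange {n = _ ∷ _} {_ ∷ _} (x∈ , _)  zero    = x∈
InBox⇒InRange {n = _ ∷ _} {_ ∷ _} (_ , v∈)  (suc i) = InBox⇒InRange v∈ i

InRange⇒InBox : ∀ {k} {n : Vec ℕ k} {v} → (∀ i → InRange (lookup n i) (lookup v i)) → InBox n v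
InRange⇒InBox {n = []}    {[]}    _  = tt
InRange⇒InBox {n = _ ∷ _} {_ ∷ _} v∈ = v∈ zero , InRange⇒InBox (v∈ ∘ suc)

/ℕ2-InRange : ∀ {m x y} → InRange m x → InRange m y → InRange m ((x ℤ.+ y) ℤD./ℕ 2)
/ℕ2-InRange {m} {+ a} {+ b} (+≤+ 1≤a , +≤+ a≤m) (+≤+ 1≤b , +≤+ b≤m) =
  +≤+ (ℕD./-monoˡ-≤ 2 (ℕP.+-mono-≤ 1≤a 1≤b)) , +≤+ (begin
    (a ℕ.+ b) ℕ./ 2 ≤⟨ ℕD./-monoˡ-≤ 2 (ℕP.+-mono-≤ a≤m b≤m) ⟩
    (m ℕ.+ m) ℕ./ 2 ≡⟨ cong (ℕ._/ 2) (trans (cong (m ℕ.+_) (sym (ℕP.+-identityʳ m))) (ℕP.*-comm 2 m)) ⟩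
    m ℕ.* 2 ℕ./ 2   ≡⟨ ℕD.m*n/n≡m m 2 ⟩
    m               ∎)
  where open ℕP.≤-Reasoning

halve-InBox : ∀ {k} (n : Vec ℕ k) {x y} → InBox n x → InBox n y → InBox n (halve (x +ₚ y))
halve-InBox []      {[]}    {[]}    _          _          = tt
halve-InBox (_ ∷ n) {_ ∷ _} {_ ∷ _} (a∈ , x∈) (b∈ , y∈) = /ℕ2-InRange a∈ b∈ , halve-InBox n x∈ y∈

face : ∀ {k} → Vec ℕ k → Fin k → Vec ℕ k
face n j = n [ j ]≔ 1

InBox-face : ∀ {k} (n : Vec ℕ k) {v} j → InBox n v → lookup v j ≡ + 1 → InBox (face n j) v
InBox-face (_ ∷ _) {_ ∷ _} zero    (_ , v∈)  refl = (ℤP.≤-refl , ℤP.≤-refl) , v∈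
InBox-face (_ ∷ n) {_ ∷ _} (suc j) (x∈ , v∈) vⱼ≡1 = x∈ , InBox-face n j v∈ vⱼ≡1

lookup*boxSize-face : ∀ {k} (n : Vec ℕ k) j → lookup n j ℕ.* boxSize (face n j) ≡ boxSize n
lookup*boxSize-face (m ∷ n) zero    = cong (m ℕ.*_) (ℕP.+-identityʳ (boxSize n))
lookup*boxSize-face (m ∷ n) (suc j) = begin
  lookup n j ℕ.* (m ℕ.* boxSize (face n j)) ≡⟨ x∙yz≈y∙xz (lookup n j) m _ ⟩
  m ℕ.* (lookup n j ℕ.* boxSize (face n j)) ≡⟨ cong (m ℕ.*_) (lookup*boxSize-face n j) ⟩
  m ℕ.* boxSize n                           ∎
  where open ≡-Reasoning

vmin≤lookup : ∀ {k} (n : Vec ℕ k) i → vmin n ≤ lookup n i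
vmin≤lookup (m ∷ [])     zero    = ℕP.≤-refl
vmin≤lookup (m ∷ _ ∷ _)  zero    = ℕP.m⊓n≤m m _
vmin≤lookup (m ∷ m′ ∷ n) (suc i) = ℕP.≤-trans (ℕP.m⊓n≤n m _) (vmin≤lookup (m′ ∷ n) i)

boxPoints : ∀ {k} → Vec ℕ k → List (Pt k)
boxPoints []      = [] ∷ []
boxPoints (m ∷ n) = cartesianProductWith _∷_ (map (λ t → + suc t) (upTo m)) (boxPoints n)

length-boxPoints : ∀ {k} (n : Vec ℕ k) → length (boxPoints n) ≡ boxSize n
length-boxPoints []      = refl
length-boxPoints (m ∷ n) = trans (length-cartesianProductWith _∷_ (map (λ t → + suc t) (upTo m)) (boxPoints n))
  (cong₂ ℕ._*_ (trans (ListP.length-map _ (upTo m)) (ListP.length-upTo m)) (length-boxPoints n))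

InBox⇒∈boxPoints : ∀ {k} (n : Vec ℕ k) {v} → InBox n v → v ∈ boxPoints n
InBox⇒∈boxPoints []      {[]}          _                         = here refl
InBox⇒∈boxPoints (m ∷ n) {+ suc t ∷ _} ((+≤+ _ , +≤+ t<m) , v∈) =
  ∈-cartesianProductWith⁺ _∷_ (∈-map⁺ (λ t → + suc t) (∈-upTo⁺ t<m)) (InBox⇒∈boxPoints n v∈)

faceBoxPoints : ∀ {k} → Vec ℕ k → List (Pt k)
faceBoxPoints {k} n = concatMap (boxPoints ∘ face n) (allFin k)

InBox-face⇒∈faceBoxPoints : ∀ {k} (n : Vec ℕ k) {v} j → InBox n v → lookup v j ≡ + 1 → v ∈ faceBoxPoints n
InBox-face⇒∈faceBoxPoints n j v∈ vⱼ≡1 =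
  ∈-concatMap⁺ (boxPoints ∘ face n) (lose (∈-allFin j) (InBox⇒∈boxPoints (face n j) (InBox-face n j v∈ vⱼ≡1)))

vmin*length-faceBoxPoints≤ : ∀ {k} (n : Vec ℕ k) → vmin n ℕ.* length (faceBoxPoints n) ≤ k ℕ.* boxSize n
vmin*length-faceBoxPoints≤ {k} n = begin
  vmin n ℕ.* length (faceBoxPoints n)  ≤⟨ *-length-concatMap≤ (boxPoints ∘ face n) (vmin n) (boxSize n) (allFin k) perFace ⟩
  length (allFin k) ℕ.* boxSize n      ≡⟨ cong (ℕ._* boxSize n) (ListP.length-tabulate {n = k} id) ⟩
  k ℕ.* boxSize n                      ∎
  where
  open ℕP.≤-Reasoning
  perFace : ∀ j → vmin n ℕ.* length (boxPoints (face n j)) ≤ boxSize n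
  perFace j = begin
    vmin n ℕ.* length (boxPoints (face n j))   ≤⟨ ℕP.*-monoˡ-≤ _ (vmin≤lookup n j) ⟩
    lookup n j ℕ.* length (boxPoints (face n j)) ≡⟨ cong (lookup n j ℕ.*_) (length-boxPoints (face n j)) ⟩
    lookup n j ℕ.* boxSize (face n j)          ≡⟨ lookup*boxSize-face n j ⟩
    boxSize n                                  ∎

bitVectors : ∀ k → List (Pt k)
bitVectors zero    = [] ∷ []
bitVectors (suc k) = cartesianProductWith _∷_ (+ 0 ∷ + 1 ∷ []) (bitVectors k)

length-bitVectors : ∀ k → length (bitVectors k) ≡ 2 ℕ.^ k
length-bitVectors zero    = refl
length-bitVectors (suc k) = trans (length-cartesianProductWith _∷_ (+ 0 ∷ + 1 ∷ []) (bitVectors k)) (cong (2 ℕ.*_) (length-bitVectors k))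

parity∈bitVectors : ∀ {k} (z : Pt k) → parity z ∈ bitVectors k
parity∈bitVectors []      = here refl
parity∈bitVectors (a ∷ z) = ∈-cartesianProductWith⁺ _∷_ bit∈ (parity∈bitVectors z)
  where
  bit∈ : + (a ℤD.%ℕ 2) ∈ + 0 ∷ + 1 ∷ []
  bit∈ with %ℕ2≡0⊎1 a
  ... | inj₁ eq = here eq
  ... | inj₂ eq = there (here eq)

module _ {k : ℕ} where

  maskedCoords : Pt k → Pt k → List ℤ
  maskedCoords e w = map (lookup w) (filter (λ i → lookup e i ℤ.≟ + 1) (allFin k))

  -- the least wᵢ with eᵢ = 1; the default is irrelevant once such an i exists
  lowest : Pt k → Pt k → ℤ
  lowest e w = min (max (+ 0) (maskedCoords e w)) (maskedCoords e w)

  slideDown : Pt k → Pt k → Pt k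
  slideDown e w = w +ₚ (+ 1 ℤ.- lowest e w) ·ₚ e

  ∈-maskedCoords : ∀ e w {i} → lookup e i ≡ + 1 → lookup w i ∈ maskedCoords e w
  ∈-maskedCoords e w eᵢ≡1 = ∈-map⁺ (lookup w) (∈-filter⁺ _ (∈-allFin _) eᵢ≡1)

  lowest≤ : ∀ e w {i} → lookup e i ≡ + 1 → lowest e w ℤ.≤ lookup w i
  lowest≤ e w eᵢ≡1 = All.lookup (min≤xs _ _) (∈-maskedCoords e w eᵢ≡1)

  lowest-attained : ∀ e w {i} → lookup e i ≡ + 1 → ∃ λ j → lookup e j ≡ + 1 × lowest e w ≡ lookup w j
  lowest-attained e w eᵢ≡1 with ∈-map⁻ (lookup w) (min∈ (∈-maskedCoords e w eᵢ≡1) (xs≤max (+ 0) (maskedCoords e w)))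
  ... | j , j∈ones , eq = j , proj₂ (∈-filter⁻ (λ i → lookup e i ℤ.≟ + 1) {xs = allFin k} j∈ones) , eq

  slide-InRange : ∀ {m a μ} → InRange m a → μ ℤ.≤ a → + 1 ℤ.≤ μ → InRange m (a ℤ.+ (+ 1 ℤ.- μ))
  slide-InRange {m} {a} {μ} (_ , a≤m) μ≤a 1≤μ =
    subst (+ 1 ℤ.≤_) (sym a+[1-μ]≡[a-μ]+1) (ℤP.+-monoˡ-≤ (+ 1) (ℤP.i≤j⇒0≤j-i μ≤a)) ,
    subst (ℤ._≤ + m) (sym a+[1-μ]≡a-[μ-1])
          (ℤP.≤-trans (ℤP.i-j≤i a (μ ℤ.- + 1) {{ℤ.nonNegative (ℤP.i≤j⇒0≤j-i 1≤μ)}}) a≤m)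
    where
    open ℤSolver.+-*-Solver
    a+[1-μ]≡[a-μ]+1 : a ℤ.+ (+ 1 ℤ.- μ) ≡ (a ℤ.- μ) ℤ.+ + 1
    a+[1-μ]≡[a-μ]+1 = solve 2 (λ a μ → a :+ (con (+ 1) :- μ) := (a :- μ) :+ con (+ 1)) refl a μ
    a+[1-μ]≡a-[μ-1] : a ℤ.+ (+ 1 ℤ.- μ) ≡ a ℤ.- (μ ℤ.- + 1)
    a+[1-μ]≡a-[μ-1] = solve 2 (λ a μ → a :+ (con (+ 1) :- μ) := a :- (μ :- con (+ 1))) refl a μ

  1≤lowest : ∀ {n : Vec ℕ k} e {w i} → InBox n w → lookup e i ≡ + 1 → + 1 ℤ.≤ lowest e w
  1≤lowest e {w} w∈B eᵢ≡1 with lowest-attained e w eᵢ≡1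
  ... | j , _ , μ≡wⱼ = subst (+ 1 ℤ.≤_) (sym μ≡wⱼ) (proj₁ (InBox⇒InRange w∈B j))

  slideDown∈faceBoxPoints : ∀ (n : Vec ℕ k) {e i w} → IsBitVector e → InBox n w → lookup e i ≡ + 1 →
                            slideDown e w ∈ faceBoxPoints n
  slideDown∈faceBoxPoints n {e} {i₀} {w} e-bits w∈B eᵢ₀≡1 with lowest-attained e w eᵢ₀≡1
  ... | j , eⱼ≡1 , μ≡wⱼ = InBox-face⇒∈faceBoxPoints n j (InRange⇒InBox inRange) slideⱼ≡1
    where
    open ℤSolver.+-*-Solver
    μ = lowest e w
    lookup-slide : ∀ {i b} → lookup e i ≡ b → lookup (slideDown e w) i ≡ lookup w i ℤ.+ (+ 1 ℤ.- μ) ℤ.* b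
    lookup-slide {i} refl = lookup-+ₚ·ₚ w (+ 1 ℤ.- μ) e i
    inRange : ∀ i → InRange (lookup n i) (lookup (slideDown e w) i)
    inRange i with e-bits i
    ... | inj₁ eᵢ≡0 = subst (InRange (lookup n i))
                        (sym (trans (lookup-slide eᵢ≡0) (trans (cong (ℤ._+_ (lookup w i)) (ℤP.*-zeroʳ (+ 1 ℤ.- μ)))
                                                                (ℤP.+-identityʳ (lookup w i)))))
                        (InBox⇒InRange w∈B i)
    ... | inj₂ eᵢ≡1 = subst (InRange (lookup n i))
                        (sym (trans (lookup-slide eᵢ≡1) (cong (ℤ._+_ (lookup w i)) (ℤP.*-identityʳ (+ 1 ℤ.- μ)))))
                        (slide-InRange (InBox⇒InRange w∈B i) (lowest≤ e w eᵢ≡1) (1≤lowest e w∈B eᵢ₀≡1))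
    slideⱼ≡1 : lookup (slideDown e w) j ≡ + 1
    slideⱼ≡1 = trans (lookup-slide eⱼ≡1) (trans (cong (λ a → a ℤ.+ (+ 1 ℤ.- μ) ℤ.* + 1) (sym μ≡wⱼ))
                 (solve 1 (λ μ → μ :+ (con (+ 1) :- μ) :* con (+ 1) := con (+ 1)) refl μ))

-- Encoding the sumset

module SumsetCount {k} (n : Vec ℕ k) {A L : List (Pt k)} (A⊆B : All (InBox n) A) (enum : EnumCoMinus A L) where

  open import Data.List.Membership.DecPropositional (_≟ₚ_ {k}) using (_∈?_)
  open import Data.List.Relation.Unary.Unique.DecPropositional.Properties (_≟ₚ_ {k}) using (deduplicate-!)

  co : List (Pt k)
  co = A ++ L

  InCo⇒∈co : ∀ {w} → InCo A w → w ∈ co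
  InCo⇒∈co {w} w∈co with w ∈? A
  ... | yes w∈A = ∈-++⁺ˡ w∈A
  ... | no  w∉A = ∈-++⁺ʳ A (proj₂ (proj₂ enum w) (w∈co , w∉A))

  Admissible : Pt k → Pt k → Set
  Admissible e w = IsBitVector e × InBox n w × InHull A (w +½ e)

  admissible-sumset : ∀ {z} → z ∈ sumset A → Admissible (parity z) (halve z)
  admissible-sumset z∈A+A with find (∈-concatMap⁻ (λ x → map (x +ₚ_) A) {xs = A} (∈-deduplicate⁻ _≟ₚ_ _ z∈A+A))
  ... | x , x∈A , z∈x+A with ∈-map⁻ (x +ₚ_) z∈x+A
  ...   | y , y∈A , refl =
    parity-isBitVector (x +ₚ y) , halve-InBox n (All.lookup A⊆B x∈A) (All.lookup A⊆B y∈A) , halve+½parity∈hull x∈A y∈A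

  -- for e = 0 the point w itself would be in the hull
  ∉co⇒∃eᵢ≡1 : ∀ {e w} → Admissible e w → w ∉ co → ∃ λ i → lookup e i ≡ + 1
  ∉co⇒∃eᵢ≡1 {e} {w} (e-bits , _ , w∈hull) w∉co
    with ¬∀⟶∃¬ k (λ i → lookup e i ≡ + 0) (λ i → lookup e i ℤ.≟ + 0)
                 (λ e≡0 → w∉co (InCo⇒∈co (subst (InHull A) (+½-zero w e e≡0) w∈hull)))
  ... | i , eᵢ≢0 with e-bits i
  ...   | inj₁ eᵢ≡0 = ⊥-elim (eᵢ≢0 eᵢ≡0)
  ...   | inj₂ eᵢ≡1 = i , eᵢ≡1

  -- among the points u of a line w + ℤe with u + e/2 in the hull, only the topmost can lie outside co A
  top-unique : ∀ {e w v a b} → InHull A (w +½ e) → InHull A (v +½ e) → v ∉ co →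
               b ℤ.≤ a → w +ₚ a ·ₚ e ≡ v +ₚ b ·ₚ e → w ≡ v
  top-unique {e} {w} {v} {a} {b} w∈hull v∈hull v∉co b≤a eq =
    steps (a ℤ.- b) (ℤP.i≤j⇒0≤j-i b≤a) (+ₚ·ₚ-cancel w v a b e eq)
    where
    steps : ∀ c → + 0 ℤ.≤ c → v ≡ w +ₚ c ·ₚ e → w ≡ v
    steps (+ zero)  _ v≡w = sym (trans v≡w (+ₚ-0·ₚ w e))
    steps (+ suc j) _ v≡ = ⊥-elim (v∉co (InCo⇒∈co (subst (InCo A) (sym v≡)
                             (InHull-ray j w∈hull (subst (λ u → InHull A (u +½ e)) v≡ v∈hull)))))

  inside≡slideDown-outside : ∀ {e w v} → Admissible e w → Admissible e v → v ∉ co → w ≡ slideDown e v → w ≡ v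
  inside≡slideDown-outside {e} {w} {v} (_ , _ , w∈hull) av@(_ , v∈B , v∈hull) v∉co eq =
    top-unique w∈hull v∈hull v∉co 1-μ≤0 (trans (+ₚ-0·ₚ w e) eq)
    where
    1-μ≤0 : + 1 ℤ.- lowest e v ℤ.≤ + 0
    1-μ≤0 = ℤP.i≤j⇒i-j≤0 (1≤lowest e v∈B (proj₂ (∉co⇒∃eᵢ≡1 av v∉co)))

  representative : Pt k → Pt k → Pt k
  representative e w with w ∈? co
  ... | yes _ = w
  ... | no  _ = slideDown e w

  representative-injective : ∀ {e w v} → Admissible e w → Admissible e v →
                             representative e w ≡ representative e v → w ≡ v
  representative-injective {e} {w} {v} aw av eq with w ∈? co | v ∈? co
  ... | yes _    | yes _    = eq
  ... | yes _    | no v∉co  = inside≡slideDown-outside aw av v∉co eq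
  ... | no w∉co  | yes _    = sym (inside≡slideDown-outside av aw w∉co (sym eq))
  ... | no w∉co  | no v∉co  with ℤP.≤-total (+ 1 ℤ.- lowest e v) (+ 1 ℤ.- lowest e w)
  ...   | inj₁ b≤a = top-unique (proj₂ (proj₂ aw)) (proj₂ (proj₂ av)) v∉co b≤a eq
  ...   | inj₂ a≤b = sym (top-unique (proj₂ (proj₂ av)) (proj₂ (proj₂ aw)) w∉co a≤b (sym eq))

  representative∈ : ∀ {e w} → Admissible e w → representative e w ∈ co ++ faceBoxPoints n
  representative∈ {e} {w} aw@(e-bits , w∈B , _) with w ∈? co
  ... | yes w∈co = ∈-++⁺ˡ w∈co
  ... | no  w∉co = ∈-++⁺ʳ co (slideDown∈faceBoxPoints n e-bits w∈B (proj₂ (∉co⇒∃eᵢ≡1 aw w∉co)))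

  encode : Pt k → Pt k × Pt k
  encode z = parity z , representative (parity z) (halve z)

  encode-injective : ∀ {z z′} → z ∈ sumset A → z′ ∈ sumset A → encode z ≡ encode z′ → z ≡ z′
  encode-injective {z} {z′} z∈ z′∈ eq = begin
    z                              ≡⟨ parity+2·halve z ⟩
    parity z +ₚ (+ 2) ·ₚ halve z    ≡⟨ cong₂ (λ p h → p +ₚ (+ 2) ·ₚ h) same-parity same-half ⟩
    parity z′ +ₚ (+ 2) ·ₚ halve z′  ≡⟨ parity+2·halve z′ ⟨
    z′                             ∎
    where
    open ≡-Reasoning
    same-parity : parity z ≡ parity z′
    same-parity = cong proj₁ eq
    same-half : halve z ≡ halve z′
    same-half = representative-injective (admissible-sumset z∈)
      (subst (λ e → Admissible e (halve z′)) (sym same-parity) (admissible-sumset z′∈))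
      (trans (cong proj₂ eq) (cong (λ e → representative e (halve z′)) (sym same-parity)))

  length-sumset≤ : length (sumset A) ≤ 2 ℕ.^ k ℕ.* (length A ℕ.+ length L ℕ.+ length (faceBoxPoints n))
  length-sumset≤ = begin
    length (sumset A)
      ≤⟨ injectiveOn⇒length≤ encode (deduplicate-! _) encode∈ encode-injective ⟩
    length (cartesianProduct (bitVectors k) (co ++ faceBoxPoints n))
      ≡⟨ length-cartesianProductWith _,_ (bitVectors k) _ ⟩
    length (bitVectors k) ℕ.* length (co ++ faceBoxPoints n)
      ≡⟨ cong₂ ℕ._*_ (length-bitVectors k) (trans (ListP.length-++ co) (cong (ℕ._+ _) (ListP.length-++ A))) ⟩
    2 ℕ.^ k ℕ.* (length A ℕ.+ length L ℕ.+ length (faceBoxPoints n)) ∎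
    where
    open ℕP.≤-Reasoning
    encode∈ : ∀ {z} → z ∈ sumset A → encode z ∈ cartesianProduct (bitVectors k) (co ++ faceBoxPoints n)
    encode∈ {z} z∈ = ∈-cartesianProduct⁺ (parity∈bitVectors z) (representative∈ (admissible-sumset z∈))

scaled-excess≤ : ∀ m s y r → m ℕ.* s ≤ m ℕ.* y ℕ.+ r → + m ℤ.* (+ s ℤ.- + y) ℤ.≤ + r
scaled-excess≤ m s y r ms≤my+r = begin
  + m ℤ.* (+ s ℤ.- + y)             ≡⟨ solve 3 (λ m s y → m :* (s :- y) := m :* s :- m :* y) refl (+ m) (+ s) (+ y) ⟩
  + m ℤ.* + s ℤ.- + m ℤ.* + y       ≡⟨ cong₂ ℤ._-_ (ℤP.pos-* m s) (ℤP.pos-* m y) ⟨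
  + (m ℕ.* s) ℤ.- + (m ℕ.* y)       ≤⟨ ℤP.+-monoˡ-≤ (ℤ.- + (m ℕ.* y)) (+≤+ ms≤my+r) ⟩
  + (m ℕ.* y ℕ.+ r) ℤ.- + (m ℕ.* y) ≡⟨ cong (ℤ._- + (m ℕ.* y)) (ℤP.pos-+ (m ℕ.* y) r) ⟩
  + (m ℕ.* y) ℤ.+ + r ℤ.- + (m ℕ.* y) ≡⟨ solve 2 (λ a r → a :+ r :- a := r) refl (+ (m ℕ.* y)) (+ r) ⟩
  + r                               ∎
  where
  open ℤP.≤-Reasoning
  open ℤSolver.+-*-Solver

excess-bound : ∀ m P s a l F K B → s ≤ P ℕ.* (a ℕ.+ l ℕ.+ F) → m ℕ.* F ≤ K ℕ.* B →
               m ℕ.* s ≤ m ℕ.* (P ℕ.* a) ℕ.+ (m ℕ.* (P ℕ.* l) ℕ.+ P ℕ.* (K ℕ.* B))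
excess-bound m P s a l F K B s≤ mF≤KB = begin
  m ℕ.* s
    ≤⟨ ℕP.*-monoʳ-≤ m s≤ ⟩
  m ℕ.* (P ℕ.* (a ℕ.+ l ℕ.+ F))
    ≡⟨ solve 5 (λ m P a l F → m :* (P :* (a :+ l :+ F)) := m :* (P :* a) :+ (m :* (P :* l) :+ P :* (m :* F)))
               refl m P a l F ⟩
  m ℕ.* (P ℕ.* a) ℕ.+ (m ℕ.* (P ℕ.* l) ℕ.+ P ℕ.* (m ℕ.* F))
    ≤⟨ ℕP.+-monoʳ-≤ (m ℕ.* (P ℕ.* a)) (ℕP.+-monoʳ-≤ (m ℕ.* (P ℕ.* l)) (ℕP.*-monoʳ-≤ P mF≤KB)) ⟩
  m ℕ.* (P ℕ.* a) ℕ.+ (m ℕ.* (P ℕ.* l) ℕ.+ P ℕ.* (K ℕ.* B)) ∎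
  where
  open ℕP.≤-Reasoning
  open ℕSolver.+-*-Solver

-- the counting argument gives the constant 2^k k; the theorem states a weaker one
weaken-constant : ∀ k B → 2 ℕ.^ k ℕ.* (k ℕ.* B) ≤ 2 ℕ.^ (k ℕ.+ 2) ℕ.* k ℕ.* (k ℕ.+ 1) ℕ.* B
weaken-constant k B = begin
  2 ℕ.^ k ℕ.* (k ℕ.* B)
    ≡⟨ solve 3 (λ P k B → P :* (k :* B) := P :* con 1 :* k :* con 1 :* B) refl (2 ℕ.^ k) k B ⟩
  2 ℕ.^ k ℕ.* 1 ℕ.* k ℕ.* 1 ℕ.* B
    ≤⟨ ℕP.*-monoˡ-≤ B (ℕP.*-mono-≤ (ℕP.*-monoˡ-≤ k (ℕP.*-monoʳ-≤ (2 ℕ.^ k) (s≤s z≤n))) (ℕP.m≤n+m 1 k)) ⟩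
  2 ℕ.^ k ℕ.* 4 ℕ.* k ℕ.* (k ℕ.+ 1) ℕ.* B
    ≡⟨ cong (λ P → P ℕ.* k ℕ.* (k ℕ.+ 1) ℕ.* B) (ℕP.^-distribˡ-+-* 2 k 2) ⟨
  2 ℕ.^ (k ℕ.+ 2) ℕ.* k ℕ.* (k ℕ.+ 1) ℕ.* B ∎
  where
  open ℕP.≤-Reasoning
  open ℕSolver.+-*-Solver

mainTheorem8 : (k : ℕ) → 1 ≤ k → (n : Vec ℕ k) → VAll.All (λ nᵢ → 1 ≤ nᵢ) n
    → (A' : List (Pt k)) → Unique A' → All (InBox n) A'
    → (L : List (Pt k)) → EnumCoMinus A' L
    → (+ vmin n) ℤ.* d k A'
    ℤ.≤ (+ vmin n) ℤ.* (+ (2 ℕ.^ k ℕ.* length L))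
    ℤ.+ (+ (2 ℕ.^ (k ℕ.+ 2) ℕ.* k ℕ.* (k ℕ.+ 1) ℕ.* boxSize n))
mainTheorem8 k _ n _ A' _ A'⊆B L enum = begin
  + m ℤ.* d k A'
    ≤⟨ scaled-excess≤ m _ _ _ (excess-bound m P _ _ _ _ k B length-sumset≤ (vmin*length-faceBoxPoints≤ n)) ⟩
  + (m ℕ.* (P ℕ.* length L) ℕ.+ P ℕ.* (k ℕ.* B))
    ≤⟨ +≤+ (ℕP.+-monoʳ-≤ (m ℕ.* (P ℕ.* length L)) (weaken-constant k B)) ⟩
  + (m ℕ.* (P ℕ.* length L) ℕ.+ C)
    ≡⟨ trans (ℤP.pos-+ _ C) (cong (ℤ._+ + C) (ℤP.pos-* m _)) ⟩
  + m ℤ.* + (P ℕ.* length L) ℤ.+ + C ∎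
  where
  open ℤP.≤-Reasoning
  open SumsetCount n A'⊆B enum using (length-sumset≤)
  m = vmin n
  P = 2 ℕ.^ k
  B = boxSize n
  C = 2 ℕ.^ (k ℕ.+ 2) ℕ.* k ℕ.* (k ℕ.+ 1) ℕ.* B
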